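{- Let $m\geq 0$ and let $A,B\subset[2^m]$ be nonempty sets of leaves of $BT_m$ with $A<B$ (every element of $A$ is less than every element of $B$). Then the root of $BT_m[A]$ is distinct from the root of $BT_m[B]$.
   Context: $BT_m$ is the perfect rooted binary tree of height $m$ ($BT_0$ a single vertex; $BT_m$ obtained by attaching two children to each leaf of $BT_{m-1}$), with leaves identified with $1,\dots,2^m$ from left to right (children of leaf $i$ of $BT_{m-1}$ become $2i-1,2i$). Ancestors/descendants: $w$ is an ancestor of $v$ if $w$ lies on the path from $v$ to the root (including $v$ itself). For a vertex set $S$, $\delta(S)$ is the common ancestor of all elements of $S$ of largest depth, $\delta(x,y)=\delta(\{x,y\})$. For nonempty $X$, $BT_m[X]$ is the rooted tree with vertex set $\{\delta(v,w):v,w\in X\}$ and root $\delta(X)$, in which distinct $x,y$ are adjacent iff one is an ancestor of the other and no other vertex of the set lies between them (descendant of one and ancestor of the other). -}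

module Defs where

open import Data.Nat using (ℕ; zero; suc; _≤_; _<_; _^_; _/_)
open import Data.Fin using (Fin; toℕ)
open import Data.Fin.Subset using (Subset; _∈_)
open import Data.Product using (_×_)

-- A vertex of BT_m is given by its depth d (0 ≤ d ≤ m) and its position
-- i (0 ≤ i < 2^d) among the vertices of depth d, counted from the left.
-- The root is (0 , 0); the children of (d , i) are (d+1 , 2i) and (d+1 , 2i+1).
-- Leaf k ∈ {1,…,2^m} of BT_m is the vertex (m , k-1).
record Vertex (m : ℕ) : Set where
  constructor vtx
  field
    depth   : ℕ
    index   : ℕ
    depth≤m : depth ≤ m
    index<  : index < 2 ^ depth

open Vertex public

-- AncDI d' j d i : the vertex at (d' , j) lies on the path from (d , i) to the root
-- (reflexive: every vertex is an ancestor of itself).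
data AncDI : ℕ → ℕ → ℕ → ℕ → Set where
  here  : ∀ {d i} → AncDI d i d i
  up    : ∀ {d' j d i} → AncDI d' j d (i / 2) → AncDI d' j (suc d) i

Ancestor : ∀ {m} → Vertex m → Vertex m → Set
Ancestor w v = AncDI (depth w) (index w) (depth v) (index v)

-- The leaf of BT_m with (0-based) label x; x : Fin (2^m) stands for leaf toℕ x + 1.
leaf : ∀ {m} → Fin (2 ^ m) → Vertex m
leaf {m} x = vtx m (toℕ x) Data.Nat.Properties.≤-refl (Data.Fin.Properties.toℕ<n x)
  where import Data.Nat.Properties
        import Data.Fin.Properties

CommonAncestor : ∀ {m} → Subset (2 ^ m) → Vertex m → Set
CommonAncestor {m} S w = ∀ (x : Fin (2 ^ m)) → x ∈ S → Ancestor w (leaf {m} x)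

IsDelta : ∀ {m} → Subset (2 ^ m) → Vertex m → Set
IsDelta {m} S v = CommonAncestor {m} S v × (∀ w → CommonAncestor {m} S w → depth w ≤ depth v)

IsRootOfInduced : ∀ {m} → Subset (2 ^ m) → Vertex m → Set
IsRootOfInduced = IsDelta

{-# OPTIONS --safe #-}
-- Suppose v = δ(A) = δ(B) sits at depth d with index j, so every leaf of A ∪ B
-- lies below v.  If v is itself a leaf, A and B share it, contradicting A < B.
-- Otherwise each leaf of A ∪ B lies below the left child 2j or the right child
-- 2j+1 of v; maximality of δ forbids A from lying entirely below the left child
-- and B entirely below the right one.  So some a ∈ A lies below 2j+1 and some
-- b ∈ B below 2j, while a < b forces the child of v above a to be left of or
-- equal to the one above b.
module Submission where

open import Defs
open import Data.Nat using (ℕ; zero; suc; _*_; _∸_; _/_; _%_; _≟_; _^_; s≤s)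
import Data.Nat as ℕ
open import Data.Nat.Properties
open import Data.Nat.DivMod
open import Data.Fin using (Fin; toℕ; _<_)
open import Data.Fin.Subset using (Subset; _∈_; Nonempty)
open import Data.Fin.Subset.Properties using (_∈?_)
open import Data.Fin.Properties using (¬∀⟶∃¬)
open import Data.Product using (_×_; _,_; ∃-syntax)
open import Data.Sum using (_⊎_; inj₁; inj₂)
open import Data.Empty using (⊥)
open import Relation.Nullary using (¬_; yes; no; contradiction)
open import Relation.Nullary.Decidable using (_→-dec_)
open import Relation.Unary using (Pred; Decidable)
open import Relation.Binary.PropositionalEquality

_/2^_ : ℕ → ℕ → ℕ
i /2^ k = (i / 2 ^ k) {{m^n≢0 2 k}}
infixl 7 _/2^_

/2^-zero : ∀ i → i /2^ 0 ≡ i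
/2^-zero = n/1≡n

/2-/2^ : ∀ i k → (i / 2) /2^ k ≡ i /2^ suc k
/2-/2^ i k = m/n/o≡m/[n*o] i 2 (2 ^ k) {{_}} {{m^n≢0 2 k}} {{m^n≢0 2 (suc k)}}

/2^-/2 : ∀ i k → (i /2^ k) / 2 ≡ i /2^ suc k
/2^-/2 i k = trans (m/n/o≡m/[n*o] i (2 ^ k) 2 {{m^n≢0 2 k}} {{_}} {{2^k*2≢0}})
                   (/-congʳ {{2^k*2≢0}} {{m^n≢0 2 (suc k)}} (*-comm (2 ^ k) 2))
  where 2^k*2≢0 = m*n≢0 (2 ^ k) 2 {{m^n≢0 2 k}}

/2^-monoˡ-≤ : ∀ k {i i′} → i ℕ.≤ i′ → i /2^ k ℕ.≤ i′ /2^ k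
/2^-monoˡ-≤ k = /-monoˡ-≤ (2 ^ k) {{m^n≢0 2 k}}

/2≡⇒≡2*⊎≡1+2* : ∀ q j → q / 2 ≡ j → q ≡ 2 * j ⊎ q ≡ suc (2 * j)
/2≡⇒≡2*⊎≡1+2* q j q/2≡j with q % 2 | m≡m%n+[m/n]*n q 2 | m%n<n q 2
... | 0           | q≡ | _ = inj₁ (trans q≡ (trans (cong (_* 2) q/2≡j) (*-comm j 2)))
... | 1           | q≡ | _ = inj₂ (trans q≡ (cong suc (trans (cong (_* 2) q/2≡j) (*-comm j 2))))
... | suc (suc _) | _  | s≤s (s≤s ())

1+2*<2^suc : ∀ {j d} → j ℕ.< 2 ^ d → suc (2 * j) ℕ.< 2 ^ suc d
1+2*<2^suc {j} {d} j< = subst (ℕ._≤ 2 * 2 ^ d) (*-suc 2 j) (*-monoʳ-≤ 2 j<)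

AncDI-/2^ : ∀ k d i → AncDI d (i /2^ k) (k ℕ.+ d) i
AncDI-/2^ zero    d i = subst (λ j → AncDI d j d i) (sym (/2^-zero i)) here
AncDI-/2^ (suc k) d i =
  up (subst (λ j → AncDI d j (k ℕ.+ d) (i / 2)) (/2-/2^ i k) (AncDI-/2^ k d (i / 2)))

AncDI⇒/2^ : ∀ {d′ j d i} → AncDI d′ j d i → ∃[ k ] d ≡ k ℕ.+ d′ × j ≡ i /2^ k
AncDI⇒/2^ {i = i} here = 0 , refl , sym (/2^-zero i)
AncDI⇒/2^ {i = i} (up p) with AncDI⇒/2^ p
... | k , refl , refl = suc k , refl , /2-/2^ i k

Ancestor-leaf⇒index : ∀ {m} (v : Vertex m) x → Ancestor v (leaf x) →
                      index v ≡ toℕ x /2^ (m ∸ depth v)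
Ancestor-leaf⇒index {m} v x v≼x with AncDI⇒/2^ v≼x
... | k , m≡k+d , j≡ = subst (λ k → index v ≡ toℕ x /2^ k) k≡m∸d j≡
  where
  k≡m∸d : k ≡ m ∸ depth v
  k≡m∸d = sym (trans (cong (_∸ depth v) m≡k+d) (m+n∸n≡m k (depth v)))

index⇒Ancestor-leaf : ∀ {m} (v : Vertex m) x → index v ≡ toℕ x /2^ (m ∸ depth v) →
                      Ancestor v (leaf x)
index⇒Ancestor-leaf {m} v x j≡ =
  subst₂ (λ j d → AncDI (depth v) j d (toℕ x)) (sym j≡) (m∸n+n≡m (depth≤m v))
         (AncDI-/2^ (m ∸ depth v) (depth v) (toℕ x))

Ancestor-leaf⇒≡ : ∀ {m} (v : Vertex m) x → depth v ≡ m → Ancestor v (leaf x) →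
                  toℕ x ≡ index v
Ancestor-leaf⇒≡ {m} v x d≡m v≼x = sym (begin
  index v                 ≡⟨ Ancestor-leaf⇒index v x v≼x ⟩
  toℕ x /2^ (m ∸ depth v) ≡⟨ cong (λ d → toℕ x /2^ (m ∸ d)) d≡m ⟩
  toℕ x /2^ (m ∸ m)       ≡⟨ cong (toℕ x /2^_) (n∸n≡0 m) ⟩
  toℕ x /2^ 0             ≡⟨ /2^-zero (toℕ x) ⟩
  toℕ x                   ∎)
  where open ≡-Reasoning

Ancestor-leaf⇒child : ∀ {m} (v : Vertex m) x → depth v ℕ.< m → Ancestor v (leaf x) →
                      toℕ x /2^ (m ∸ suc (depth v)) ≡ 2 * index v
                      ⊎ toℕ x /2^ (m ∸ suc (depth v)) ≡ suc (2 * index v)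
Ancestor-leaf⇒child {m} v x d<m v≼x = /2≡⇒≡2*⊎≡1+2* _ (index v) (sym (begin
  index v                             ≡⟨ Ancestor-leaf⇒index v x v≼x ⟩
  toℕ x /2^ (m ∸ depth v)             ≡⟨ cong (toℕ x /2^_) (+-∸-assoc 1 d<m) ⟩
  toℕ x /2^ suc (m ∸ suc (depth v))   ≡⟨ /2^-/2 (toℕ x) (m ∸ suc (depth v)) ⟨
  toℕ x /2^ (m ∸ suc (depth v)) / 2   ∎))
  where open ≡-Reasoning

¬∀∈⇒∃∈¬ : ∀ {n p} (S : Subset n) {P : Pred (Fin n) p} → Decidable P →
          ¬ (∀ x → x ∈ S → P x) → ∃[ x ] x ∈ S × ¬ P x
¬∀∈⇒∃∈¬ {n} S {P} P? ¬∀P with ¬∀⟶∃¬ n (λ x → x ∈ S → P x) (λ x → (x ∈? S) →-dec P? x) ¬∀P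
... | x , ¬[x∈S→Px] with x ∈? S
...   | yes x∈S = x , x∈S , λ Px → ¬[x∈S→Px] (λ _ → Px)
...   | no  x∉S = contradiction (λ x∈S → contradiction x∈S x∉S) ¬[x∈S→Px]

-- No vertex of depth greater than δ(S) is a common ancestor of S.
IsDelta⇒spread : ∀ {m} {S : Subset (2 ^ m)} {v : Vertex m} → IsDelta S v →
                 (d<m : depth v ℕ.< m) → ∀ t → t ℕ.< 2 ^ suc (depth v) →
                 ∃[ x ] x ∈ S × toℕ x /2^ (m ∸ suc (depth v)) ≢ t
IsDelta⇒spread {m} {S} {v} (_ , deepest) d<m t t< =
  ¬∀∈⇒∃∈¬ S (λ x → toℕ x /2^ (m ∸ suc (depth v)) ≟ t) all-below-w-absurd
  where
  w : Vertex m
  w = vtx (suc (depth v)) t d<m t<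
  all-below-w-absurd : ¬ (∀ x → x ∈ S → toℕ x /2^ (m ∸ suc (depth v)) ≡ t)
  all-below-w-absurd all-below =
    1+n≰n (deepest w (λ x x∈S → index⇒Ancestor-leaf w x (sym (all-below x x∈S))))

separated-IsDelta-absurd : ∀ {m} {A B : Subset (2 ^ m)} {v : Vertex m} →
                           Nonempty A → Nonempty B →
                           (∀ x y → x ∈ A → y ∈ B → x < y) →
                           IsDelta A v → IsDelta B v → ⊥
separated-IsDelta-absurd {m} {A} {B} {v} (a , a∈A) (b , b∈B) A<B δA@(v≼A , _) δB@(v≼B , _)
  with m≤n⇒m<n∨m≡n (depth≤m v)
... | inj₂ d≡m =
  <-irrefl (trans (Ancestor-leaf⇒≡ v a d≡m (v≼A a a∈A))
                  (sym (Ancestor-leaf⇒≡ v b d≡m (v≼B b b∈B))))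
           (A<B a b a∈A b∈B)
... | inj₁ d<m
  with IsDelta⇒spread {S = A} {v} δA d<m (2 * index v) (≤-trans (n≤1+n _) (1+2*<2^suc {d = depth v} (index< v)))
     | IsDelta⇒spread {S = B} {v} δB d<m (suc (2 * index v)) (1+2*<2^suc {d = depth v} (index< v))
... | a′ , a′∈A , a′≢left | b′ , b′∈B , b′≢right
  with Ancestor-leaf⇒child v a′ d<m (v≼A a′ a′∈A) | Ancestor-leaf⇒child v b′ d<m (v≼B b′ b′∈B)
... | inj₁ a′-left  | _             = a′≢left a′-left
... | _             | inj₂ b′-right = b′≢right b′-right
... | inj₂ a′-right | inj₁ b′-left  =
  1+n≰n (subst₂ ℕ._≤_ a′-right b′-left
                 (/2^-monoˡ-≤ (m ∸ suc (depth v)) {toℕ a′} {toℕ b′} (<⇒≤ (A<B a′ b′ a′∈A b′∈B))))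

claim2 : (m : ℕ) (A B : Subset (2 ^ m)) →
         Nonempty A → Nonempty B →
         (∀ x y → x ∈ A → y ∈ B → x < y) →
         (r s : Vertex m) → IsRootOfInduced A r → IsRootOfInduced B s →
         r ≢ s
claim2 m A B ne-A ne-B A<B r .r δA δB refl = separated-IsDelta-absurd {A = A} {B} {r} ne-A ne-B A<B δA δB
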